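{- Asymptotically almost every $\lambda$-term is neither strongly normalising, nor typeable, nor in normal form: the proportion of $\lambda$-terms of size $n$ that are strongly normalising (respectively typeable, respectively in $\beta$-normal form) tends to $0$ as $n\to\infty$.
   Context: $\lambda$-terms in de Bruijn notation are generated by $T ::= \underline{\mathsf{n}} \mid \lambda T \mid T\,T$, indices by $\underline{\mathsf{0}}$ and $S\,\underline{\mathsf{n}}$; size: $|\lambda N|=|N|+1$, $|N\,M|=|N|+|M|+1$, $|S\,\underline{\mathsf{n}}|=|\underline{\mathsf{n}}|+1$, $|\underline{\mathsf{0}}|=1$. A term is in $\beta$-normal form if it has no subterm of the form $(\lambda N)\,M$; it is strongly normalising if every $\beta$-reduction sequence from it is finite. "Typeable" refers to typeability in the simply typed $\lambda$-calculus (in which $(\lambda(\underline{\mathsf{0}}\,\underline{\mathsf{0}}))(\lambda(\underline{\mathsf{0}}\,\underline{\mathsf{0}}))$ and any term containing it are untypeable). -}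

module Defs where

open import Data.Nat using (ℕ; zero; suc; pred; _+_; _*_; _≤_; _≡ᵇ_; _<ᵇ_)
open import Data.Bool using (if_then_else_)
open import Data.List using (List; []; _∷_; length)
open import Data.List.Relation.Unary.All using (All)
open import Data.List.Relation.Unary.Unique.Propositional using (Unique)
open import Data.Product using (Σ; ∃-syntax; _×_)
open import Relation.Binary.PropositionalEquality using (_≡_)
open import Relation.Nullary using (¬_)

-- λ-terms in de Bruijn notation (indices are natural numbers n = Sⁿ 0)
data Term : Set where
  var : ℕ → Term
  lam : Term → Term
  app : Term → Term → Term

size : Term → ℕ
size (var n)   = suc n
size (lam t)   = suc (size t)
size (app t u) = suc (size t + size u)

shift : ℕ → Term → Term
shift c (var k)   = if k <ᵇ c then var k else var (suc k)
shift c (lam t)   = lam (shift (suc c) t)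
shift c (app t u) = app (shift c t) (shift c u)

sub : ℕ → Term → Term → Term
sub j s (var k)   = if k ≡ᵇ j then s else (if j <ᵇ k then var (pred k) else var k)
sub j s (lam t)   = lam (sub (suc j) (shift 0 s) t)
sub j s (app t u) = app (sub j s t) (sub j s u)

infix 4 _⟶β_
data _⟶β_ : Term → Term → Set where
  β    : ∀ {N M} → app (lam N) M ⟶β sub 0 M N
  ξlam : ∀ {t t'} → t ⟶β t' → lam t ⟶β lam t'
  ξl   : ∀ {t t' u} → t ⟶β t' → app t u ⟶β app t' u
  ξr   : ∀ {t u u'} → u ⟶β u' → app t u ⟶β app t u'

-- strong normalisation: no infinite β-reduction sequence (inductive / accessibility form)
data SN (t : Term) : Set where
  sn : (∀ {u} → t ⟶β u → SN u) → SN t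

data HasRedex : Term → Set where
  here : ∀ {N M} → HasRedex (app (lam N) M)
  inLam : ∀ {t} → HasRedex t → HasRedex (lam t)
  inL  : ∀ {t u} → HasRedex t → HasRedex (app t u)
  inR  : ∀ {t u} → HasRedex u → HasRedex (app t u)

NormalForm : Term → Set
NormalForm t = ¬ HasRedex t

infixr 7 _⇒_
data Ty : Set where
  base : ℕ → Ty
  _⇒_  : Ty → Ty → Ty

Ctx : Set
Ctx = List Ty

infix 4 _∋_∶_ _⊢_∶_
data _∋_∶_ : Ctx → ℕ → Ty → Set where
  here  : ∀ {Γ A} → (A ∷ Γ) ∋ zero ∶ A
  there : ∀ {Γ A B n} → Γ ∋ n ∶ A → (B ∷ Γ) ∋ suc n ∶ A

data _⊢_∶_ : Ctx → Term → Ty → Set where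
  ⊢var : ∀ {Γ n A} → Γ ∋ n ∶ A → Γ ⊢ var n ∶ A
  ⊢lam : ∀ {Γ t A B} → (A ∷ Γ) ⊢ t ∶ B → Γ ⊢ lam t ∶ A ⇒ B
  ⊢app : ∀ {Γ t u A B} → Γ ⊢ t ∶ A ⇒ B → Γ ⊢ u ∶ A → Γ ⊢ app t u ∶ B

Typeable : Term → Set
Typeable t = ∃[ Γ ] ∃[ A ] (Γ ⊢ t ∶ A)

-- "the proportion of terms of size n satisfying P tends to 0":
-- for every k, for all large n, any k·(#size-n terms with P) is ≤ #size-n terms.
-- Counts are expressed via duplicate-free lists (P need not be decidable):
-- every duplicate-free list xs of size-n P-terms is outnumbered k-fold by some
-- duplicate-free list ys of size-n terms.
AsymptoticallyNegligible : (Term → Set) → Set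
AsymptoticallyNegligible P =
  ∀ (k : ℕ) → ∃[ N ] ∀ (n : ℕ) → N ≤ n →
    ∀ (xs : List Term) → Unique xs → All (λ t → size t ≡ n × P t) xs →
    Σ (List Term) (λ ys → Unique ys × All (λ t → size t ≡ n) ys × (k * length xs ≤ length ys))

-- All three properties force a term to be Ω-free, where Ω = (λx.xx)(λx.xx)
-- (§1), so it suffices to show that Ω-free terms are asymptotically negligible,
-- which we do by counting injectively.  A local rewrite replaces the subterm at
-- the root of a term by a term of the same size that contains Ω at a fixed depth
-- and determines the replaced subterm (§4, §6).  In an Ω-free term the planted
-- Ω also pins down the position, so one rewrite applied at every position sends
-- distinct Ω-free terms of size n to disjoint sets of distinct terms of size n
-- (§6).  Finitely many rewrites suffice (§7): one turns a variable of index
-- m ≥ 10 into any of m ∸ 9 gadgets Ω (λⁱ j), and one per heavy depth-10 fragment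
-- replaces that fragment by Ω applied to its holes (§3).  Weight counting (§8)
-- shows that the size of a term is linear in its number of replacements, so
-- every large Ω-free term has many; pigeonhole over the rewrites (§9) then turns
-- any list of Ω-free terms of size n into k times as many terms of size n.
module Submission where

open import Defs
open import Data.Bool using (true; false; T; if_then_else_)
open import Data.Empty using (⊥-elim)
open import Data.List using (List; []; _∷_; [_]; length; _++_; map; upTo; cartesianProductWith)
open import Data.List.Properties using (length-++; length-map; ++-assoc; length-applyUpTo)
open import Data.List.Membership.Propositional using (_∈_)
open import Data.List.Membership.Propositional.Properties
  using (∈-map⁺; ∈-map⁻; ∈-++⁺ˡ; ∈-++⁺ʳ; ∈-++⁻; ∈-upTo⁺; ∈-upTo⁻; ∈-cartesianProductWith⁺)
open import Data.List.Relation.Unary.All as All using (All; []; _∷_)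
open import Data.List.Relation.Unary.All.Properties as AllP using ()
open import Data.List.Relation.Unary.AllPairs using ([]; _∷_)
open import Data.List.Relation.Unary.Any using (here; there)
open import Data.List.Relation.Unary.Unique.Propositional using (Unique)
import Data.List.Relation.Unary.Unique.Propositional.Properties as Unique
open import Data.Nat
open import Data.Nat.Properties
open import Data.Nat.Tactic.RingSolver using (solve-∀)
open import Algebra.Properties.CommutativeSemigroup +-commutativeSemigroup using (interchange)
open import Data.Product using (Σ; ∃-syntax; _×_; _,_; proj₁; proj₂)
open import Data.Sum using (inj₁; inj₂)
open import Relation.Binary.PropositionalEquality hiding ([_])
open import Relation.Nullary using (¬_; Dec; yes; no)

-- §1. Strongly normalising, typeable and normal terms never contain
-- Ω = (λx.xx)(λx.xx).

Δ : Term
Δ = lam (app (var 0) (var 0))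

Ω : Term
Ω = app Δ Δ

-- Occ t d : Ω occurs in t as a subterm at depth d.  The root case takes an
-- equation, so that occurrences in terms of unknown shape can still be matched.
data Occ : Term → ℕ → Set where
  here : ∀ {t} → t ≡ Ω → Occ t zero
  oLam : ∀ {s d} → Occ s d → Occ (lam s) (suc d)
  oL   : ∀ {u v d} → Occ u d → Occ (app u v) (suc d)
  oR   : ∀ {u v d} → Occ v d → Occ (app u v) (suc d)

Ω-free : Term → Set
Ω-free t = ∀ {d} → ¬ Occ t d

occ-redex : ∀ {t d} → Occ t d → HasRedex t
occ-redex (here refl) = here
occ-redex (oLam o)    = inLam (occ-redex o)
occ-redex (oL o)      = inL (occ-redex o)
occ-redex (oR o)      = inR (occ-redex o)

NF⇒Ω-free : ∀ {t} → NormalForm t → Ω-free t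
NF⇒Ω-free nf o = nf (occ-redex o)

SN-lam : ∀ {s} → SN (lam s) → SN s
SN-lam (sn f) = sn (λ r → SN-lam (f (ξlam r)))

SN-appL : ∀ {u v} → SN (app u v) → SN u
SN-appL (sn f) = sn (λ r → SN-appL (f (ξl r)))

SN-appR : ∀ {u v} → SN (app u v) → SN v
SN-appR (sn f) = sn (λ r → SN-appR (f (ξr r)))

¬SN-Ω : ¬ SN Ω
¬SN-Ω (sn f) = ¬SN-Ω (f β)

SN⇒Ω-free : ∀ {t} → SN t → Ω-free t
SN⇒Ω-free s (here refl) = ¬SN-Ω s
SN⇒Ω-free s (oLam o)    = SN⇒Ω-free (SN-lam s) o
SN⇒Ω-free s (oL o)      = SN⇒Ω-free (SN-appL s) o
SN⇒Ω-free s (oR o)      = SN⇒Ω-free (SN-appR s) o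

-- Subterms of typeable terms are typeable, but Ω is not: the self-application
-- in Δ would need a type A with A ≡ A ⇒ B.
¬typed-Ω : ∀ {Γ A} → ¬ (Γ ⊢ Ω ∶ A)
¬typed-Ω (⊢app (⊢lam (⊢app (⊢var here) (⊢var ()))) _)

typed⇒Ω-free : ∀ {Γ t A d} → Γ ⊢ t ∶ A → ¬ Occ t d
typed⇒Ω-free ⊢t         (here refl) = ¬typed-Ω ⊢t
typed⇒Ω-free (⊢lam ⊢s)   (oLam o)   = typed⇒Ω-free ⊢s o
typed⇒Ω-free (⊢app ⊢u _) (oL o)     = typed⇒Ω-free ⊢u o
typed⇒Ω-free (⊢app _ ⊢v) (oR o)     = typed⇒Ω-free ⊢v o

Typeable⇒Ω-free : ∀ {t} → Typeable t → Ω-free t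
Typeable⇒Ω-free (_ , _ , ⊢t) = typed⇒Ω-free ⊢t

sumOf : {A : Set} → (A → ℕ) → List A → ℕ
sumOf f []       = 0
sumOf f (x ∷ xs) = f x + sumOf f xs

module _ {A : Set} where

  sumOf-++ : (f : A → ℕ) (xs ys : List A) → sumOf f (xs ++ ys) ≡ sumOf f xs + sumOf f ys
  sumOf-++ f []       ys = refl
  sumOf-++ f (x ∷ xs) ys = trans (cong (f x +_) (sumOf-++ f xs ys)) (sym (+-assoc (f x) _ _))

  sumOf-+ : (f g : A → ℕ) (xs : List A) → sumOf (λ x → f x + g x) xs ≡ sumOf f xs + sumOf g xs
  sumOf-+ f g []       = refl
  sumOf-+ f g (x ∷ xs) =
    trans (cong (f x + g x +_) (sumOf-+ f g xs)) (interchange (f x) (g x) (sumOf f xs) (sumOf g xs))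

  sumOf-* : (c : ℕ) (f : A → ℕ) (xs : List A) → sumOf (λ x → c * f x) xs ≡ c * sumOf f xs
  sumOf-* c f []       = sym (*-zeroʳ c)
  sumOf-* c f (x ∷ xs) = trans (cong (c * f x +_) (sumOf-* c f xs)) (sym (*-distribˡ-+ c (f x) _))

  sumOf-mono : {f g : A → ℕ} → (∀ x → f x ≤ g x) → (xs : List A) → sumOf f xs ≤ sumOf g xs
  sumOf-mono f≤g []       = z≤n
  sumOf-mono f≤g (x ∷ xs) = +-mono-≤ (f≤g x) (sumOf-mono f≤g xs)

  sumOf-cong : {f g : A → ℕ} → (∀ x → f x ≡ g x) → (xs : List A) → sumOf f xs ≡ sumOf g xs
  sumOf-cong f≡g []       = refl
  sumOf-cong f≡g (x ∷ xs) = cong₂ _+_ (f≡g x) (sumOf-cong f≡g xs)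

  sumOf-∈ : (f : A → ℕ) {x : A} {xs : List A} → x ∈ xs → f x ≤ sumOf f xs
  sumOf-∈ f {xs = y ∷ ys} (here refl) = m≤m+n (f y) _
  sumOf-∈ f {xs = y ∷ ys} (there x∈) = ≤-trans (sumOf-∈ f x∈) (m≤n+m _ (f y))

  sumOf-lower : (c : ℕ) (f : A → ℕ) {xs : List A} → All (λ x → c ≤ f x) xs → length xs * c ≤ sumOf f xs
  sumOf-lower c f []         = z≤n
  sumOf-lower c f (c≤ ∷ c≤s) = +-mono-≤ c≤ (sumOf-lower c f c≤s)

  pigeonhole : (c : ℕ) (f : A → ℕ) (x : A) (xs : List A) → length (x ∷ xs) * c ≤ sumOf f (x ∷ xs) →
               ∃[ y ] c ≤ f y
  pigeonhole c f x xs big with c ≤? f x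
  ... | yes c≤ = x , c≤
  pigeonhole c f x []       big | no c≰ = ⊥-elim (c≰ (subst₂ _≤_ (+-identityʳ c) (+-identityʳ (f x)) big))
  pigeonhole c f x (y ∷ ys) big | no c≰ =
    pigeonhole c f y ys (+-cancelˡ-≤ c _ _ (≤-trans big (+-monoˡ-≤ _ (<⇒≤ (≰⇒> c≰)))))

sumOf-swap : {A B : Set} (f : A → B → ℕ) (xs : List A) (ys : List B) →
             sumOf (λ x → sumOf (f x) ys) xs ≡ sumOf (λ y → sumOf (λ x → f x y) xs) ys
sumOf-swap f []       ys = sym (zeros ys)
  where
  zeros : (zs : List _) → sumOf (λ _ → 0) zs ≡ 0
  zeros []       = refl
  zeros (_ ∷ zs) = zeros zs
sumOf-swap f (x ∷ xs) ys =
  trans (cong (sumOf (f x) ys +_) (sumOf-swap f xs ys)) (sym (sumOf-+ (f x) _ ys))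

-- §3. Fragments.  A pattern is the top part of a term, with holes where
-- subterms were cut off.

data Pat : Set where
  hole : Pat
  pvar : ℕ → Pat
  plam : Pat → Pat
  papp : Pat → Pat → Pat

_≟ₚ_ : (p q : Pat) → Dec (p ≡ q)
hole     ≟ₚ hole       = yes refl
hole     ≟ₚ pvar _     = no λ ()
hole     ≟ₚ plam _     = no λ ()
hole     ≟ₚ papp _ _   = no λ ()
pvar _   ≟ₚ hole       = no λ ()
pvar m   ≟ₚ pvar n     with m ≟ n
... | yes refl = yes refl
... | no m≢n   = no λ { refl → m≢n refl }
pvar _   ≟ₚ plam _     = no λ ()
pvar _   ≟ₚ papp _ _   = no λ ()
plam _   ≟ₚ hole       = no λ ()
plam _   ≟ₚ pvar _     = no λ ()
plam p   ≟ₚ plam q     with p ≟ₚ q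
... | yes refl = yes refl
... | no p≢q   = no λ { refl → p≢q refl }
plam _   ≟ₚ papp _ _   = no λ ()
papp _ _ ≟ₚ hole       = no λ ()
papp _ _ ≟ₚ pvar _     = no λ ()
papp _ _ ≟ₚ plam _     = no λ ()
papp p p' ≟ₚ papp q q' with p ≟ₚ q | p' ≟ₚ q'
... | yes refl | yes refl = yes refl
... | no p≢q   | _        = no λ { refl → p≢q refl }
... | yes _    | no p'≢q' = no λ { refl → p'≢q' refl }

-- Only variables of index < 10 are kept in the pattern
-- (larger ones become holes), so that there are finitely many fragments of each
-- depth.
frag : ℕ → Term → Pat
frag zero    t         = hole
frag (suc d) (var m)   = if m <ᵇ 10 then pvar m else hole
frag (suc d) (lam s)   = plam (frag d s)
frag (suc d) (app u v) = papp (frag d u) (frag d v)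

holes : ℕ → Term → List Term
holes zero    t         = [ t ]
holes (suc d) (var m)   = if m <ᵇ 10 then [] else [ var m ]
holes (suc d) (lam s)   = holes d s
holes (suc d) (app u v) = holes d u ++ holes d v

fill : Pat → List Term → Term × List Term
fill hole       []       = var 0 , []
fill hole       (h ∷ hs) = h , hs
fill (pvar m)   hs       = var m , hs
fill (plam p)   hs       = let (s , rest) = fill p hs in lam s , rest
fill (papp p q) hs       = let (u , rest) = fill p hs ; (v , rest') = fill q rest in app u v , rest'

fill-frag : ∀ d t rest → fill (frag d t) (holes d t ++ rest) ≡ (t , rest)
fill-frag zero    t         rest = refl
fill-frag (suc d) (var m)   rest with m <ᵇ 10
... | true  = refl
... | false = refl
fill-frag (suc d) (lam s)   rest rewrite fill-frag d s rest = refl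
fill-frag (suc d) (app u v) rest
  rewrite ++-assoc (holes d u) (holes d v) rest | fill-frag d u (holes d v ++ rest) | fill-frag d v rest = refl

frag-holes-injective : ∀ d {t₁ t₂} → frag d t₁ ≡ frag d t₂ → holes d t₁ ≡ holes d t₂ → t₁ ≡ t₂
frag-holes-injective d {t₁} {t₂} f≡ h≡ = cong proj₁ (begin
  (t₁ , []) ≡⟨ sym (fill-frag d t₁ []) ⟩
  fill (frag d t₁) (holes d t₁ ++ []) ≡⟨ cong₂ (λ π hs → fill π (hs ++ [])) f≡ h≡ ⟩
  fill (frag d t₂) (holes d t₂ ++ []) ≡⟨ fill-frag d t₂ [] ⟩
  (t₂ , []) ∎)
  where open ≡-Reasoning

patSize : Pat → ℕ
patSize hole       = 0
patSize (pvar m)   = suc m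
patSize (plam p)   = suc (patSize p)
patSize (papp p q) = suc (patSize p + patSize q)

holeCount : Pat → ℕ
holeCount hole       = 1
holeCount (pvar _)   = 0
holeCount (plam p)   = holeCount p
holeCount (papp p q) = holeCount p + holeCount q

patWeight : Pat → ℕ
patWeight hole       = 0
patWeight (pvar _)   = 2
patWeight (plam p)   = suc (patWeight p)
patWeight (papp p q) = patWeight p + patWeight q

size-frag : ∀ d t → size t ≡ patSize (frag d t) + sumOf size (holes d t)
size-frag zero    t       = sym (+-identityʳ (size t))
size-frag (suc d) (var m) with m <ᵇ 10
... | true  = sym (+-identityʳ (suc m))
... | false = sym (+-identityʳ (suc m))
size-frag (suc d) (lam s) = cong suc (size-frag d s)
size-frag (suc d) (app u v)
  rewrite size-frag d u | size-frag d v | sumOf-++ size (holes d u) (holes d v) =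
  cong suc (interchange (patSize (frag d u)) _ (patSize (frag d v)) _)

length-holes : ∀ d t → length (holes d t) ≡ holeCount (frag d t)
length-holes zero    t       = refl
length-holes (suc d) (var m) with m <ᵇ 10
... | true  = refl
... | false = refl
length-holes (suc d) (lam s) = length-holes d s
length-holes (suc d) (app u v) =
  trans (length-++ (holes d u)) (cong₂ _+_ (length-holes d u) (length-holes d v))

-- Weight never exceeds the material: every unit of weight or hole is paid for
-- by one unit of size.  Hence heavy patterns leave room for a gadget.
weight-bound : ∀ π → patWeight π + holeCount π ≤ suc (patSize π)
weight-bound hole       = ≤-refl
weight-bound (pvar m)   = s≤s (s≤s z≤n)
weight-bound (plam p)   = s≤s (weight-bound p)
weight-bound (papp p q) = begin
  patWeight p + patWeight q + (holeCount p + holeCount q)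
    ≡⟨ interchange (patWeight p) (patWeight q) (holeCount p) (holeCount q) ⟩
  (patWeight p + holeCount p) + (patWeight q + holeCount q)    ≤⟨ +-mono-≤ (weight-bound p) (weight-bound q) ⟩
  suc (patSize p) + suc (patSize q)        ≡⟨ cong suc (+-suc (patSize p) (patSize q)) ⟩
  suc (suc (patSize p + patSize q))        ∎
  where open ≤-Reasoning

holes-Ω-free : ∀ d t → Ω-free t → All Ω-free (holes d t)
holes-Ω-free zero    t         a = (λ {d} → a {d}) ∷ []
holes-Ω-free (suc d) (var m)   a with m <ᵇ 10
... | true  = []
... | false = (λ {d} → a {d}) ∷ []
holes-Ω-free (suc d) (lam s)   a = holes-Ω-free d s (λ o → a (oLam o))
holes-Ω-free (suc d) (app u v) a =
  AllP.++⁺ (holes-Ω-free d u (λ o → a (oL o))) (holes-Ω-free d v (λ o → a (oR o)))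

fragments : ℕ → List Pat
fragments zero    = [ hole ]
fragments (suc d) =
  hole ∷ (map pvar (upTo 10) ++ (map plam (fragments d) ++ cartesianProductWith papp (fragments d) (fragments d)))

frag∈fragments : ∀ d t → frag d t ∈ fragments d
frag∈fragments zero    t       = here refl
frag∈fragments (suc d) (var m) with m <ᵇ 10 in small
... | true  = there (∈-++⁺ˡ (∈-map⁺ pvar (∈-upTo⁺ (<ᵇ⇒< m 10 (subst T (sym small) _)))))
... | false = here refl
frag∈fragments (suc d) (lam s) =
  there (∈-++⁺ʳ (map pvar (upTo 10)) (∈-++⁺ˡ (∈-map⁺ plam (frag∈fragments d s))))
frag∈fragments (suc d) (app u v) =
  there (∈-++⁺ʳ (map pvar (upTo 10)) (∈-++⁺ʳ (map plam (fragments d))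
    (∈-cartesianProductWith⁺ papp (frag∈fragments d u) (frag∈fragments d v))))

-- §4. Gadgets: terms containing Ω, of the same size as the subterm they
-- replace, from which that subterm can be recovered.

lam-injective : ∀ {s s'} → lam s ≡ lam s' → s ≡ s'
lam-injective refl = refl

app-injectiveˡ : ∀ {u u' v v'} → app u v ≡ app u' v' → u ≡ u'
app-injectiveˡ refl = refl

app-injectiveʳ : ∀ {u u' v v'} → app u v ≡ app u' v' → v ≡ v'
app-injectiveʳ refl = refl

lamN : ℕ → Term → Term
lamN zero    t = t
lamN (suc k) t = lam (lamN k t)

size-lamN : ∀ k t → size (lamN k t) ≡ k + size t
size-lamN zero    t = refl
size-lamN (suc k) t = cong suc (size-lamN k t)

lamN-injective : ∀ k {t t'} → lamN k t ≡ lamN k t' → t ≡ t'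
lamN-injective zero    e = e
lamN-injective (suc k) e = lamN-injective k (lam-injective e)

lamN-occ : ∀ k {t d} → Occ t d → Occ (lamN k t) (k + d)
lamN-occ zero    o = o
lamN-occ (suc k) o = oLam (lamN-occ k o)

occ-lamN : ∀ k {t e} → (∀ {d} → Occ t d → d ≡ e) → ∀ {d} → Occ (lamN k t) d → d ≡ k + e
occ-lamN zero    exact o        = exact o
occ-lamN (suc k) exact (oLam o) = cong suc (occ-lamN k exact o)

var-Ω-free : ∀ {m d} → ¬ Occ (var m) d
var-Ω-free (here ())

Δ-Ω-free : ∀ {d} → ¬ Occ Δ d
Δ-Ω-free (here ())
Δ-Ω-free (oLam (oL o)) = var-Ω-free o
Δ-Ω-free (oLam (oR o)) = var-Ω-free o

occ-Ω : ∀ {d} → Occ Ω d → d ≡ 0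
occ-Ω (here _) = refl
occ-Ω (oL o)   = ⊥-elim (Δ-Ω-free o)
occ-Ω (oR o)   = ⊥-elim (Δ-Ω-free o)

spine : List Term → Term
spine []       = Ω
spine (h ∷ hs) = app (spine hs) h

size-spine : ∀ hs → size (spine hs) ≡ 9 + (length hs + sumOf size hs)
size-spine []       = refl
size-spine (h ∷ hs) = trans (cong (λ n → suc (n + size h)) (size-spine hs))
                             (rearrange (length hs) (sumOf size hs) (size h))
  where
  rearrange : ∀ l s h → suc (9 + (l + s) + h) ≡ 9 + (suc l + (h + s))
  rearrange = solve-∀

spine≢Δ : ∀ hs → spine hs ≢ Δ
spine≢Δ []      ()
spine≢Δ (_ ∷ _) ()

spine-injective : ∀ {hs hs'} → spine hs ≡ spine hs' → hs ≡ hs'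
spine-injective {[]}     {[]}      e = refl
spine-injective {[]}     {_ ∷ hs'} e = ⊥-elim (spine≢Δ hs' (sym (app-injectiveˡ e)))
spine-injective {_ ∷ hs} {[]}      e = ⊥-elim (spine≢Δ hs (app-injectiveˡ e))
spine-injective {_ ∷ _}  {_ ∷ _}   e =
  cong₂ _∷_ (app-injectiveʳ e) (spine-injective (app-injectiveˡ e))

spine-occ : ∀ hs → Occ (spine hs) (length hs)
spine-occ []       = here refl
spine-occ (h ∷ hs) = oL (spine-occ hs)

occ-spine : ∀ hs → All Ω-free hs → ∀ {d} → Occ (spine hs) d → d ≡ length hs
occ-spine []       _        o         = occ-Ω o
occ-spine (h ∷ hs) _        (here eq) = ⊥-elim (spine≢Δ hs (app-injectiveˡ eq))
occ-spine (h ∷ hs) (_ ∷ as) (oL o)    = cong suc (occ-spine hs as o)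
occ-spine (h ∷ hs) (a ∷ _)  (oR o)    = ⊥-elim (a o)

-- The pattern gadget for π replaces a subterm whose fragment is π by Ω applied
-- to its holes, padded with λs to the original size.
pad : Pat → ℕ
pad π = patSize π ∸ (9 + holeCount π)

gadget : Pat → List Term → Term
gadget π hs = lamN (pad π) (spine hs)

gadget-size : ∀ π hs → 10 ≤ patWeight π → length hs ≡ holeCount π →
              size (gadget π hs) ≡ patSize π + sumOf size hs
gadget-size π hs heavy len = begin
  size (lamN (pad π) (spine hs))               ≡⟨ size-lamN (pad π) (spine hs) ⟩
  pad π + size (spine hs)                      ≡⟨ cong (pad π +_) (size-spine hs) ⟩
  pad π + (9 + (length hs + sumOf size hs))    ≡⟨ cong (λ l → pad π + (9 + (l + sumOf size hs))) len ⟩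
  pad π + (9 + (holeCount π + sumOf size hs))  ≡⟨ cong (pad π +_) (sym (+-assoc 9 (holeCount π) _)) ⟩
  pad π + (9 + holeCount π + sumOf size hs)    ≡⟨ sym (+-assoc (pad π) (9 + holeCount π) _) ⟩
  pad π + (9 + holeCount π) + sumOf size hs    ≡⟨ cong (_+ sumOf size hs) (m∸n+n≡m room) ⟩
  patSize π + sumOf size hs                    ∎
  where
  open ≡-Reasoning
  room : 9 + holeCount π ≤ patSize π
  room = ≤-pred (≤-trans (+-monoˡ-≤ (holeCount π) heavy) (weight-bound π))

gadget-occ : ∀ π hs → Occ (gadget π hs) (pad π + length hs)
gadget-occ π hs = lamN-occ (pad π) (spine-occ hs)

occ-gadget : ∀ π hs → All Ω-free hs → ∀ {d} → Occ (gadget π hs) d → d ≡ pad π + length hs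
occ-gadget π hs av = occ-lamN (pad π) (occ-spine hs av)

varGadget : ℕ → ℕ → Term
varGadget m i = app Ω (lamN i (var (m ∸ 10 ∸ i)))

varGadgets : ℕ → List Term
varGadgets m = map (varGadget m) (upTo (m ∸ 9))

varGadget-room : ∀ m {i} → i < m ∸ 9 → 10 + i ≤ m
varGadget-room m {i} i< = begin
  10 + i      ≡⟨ trans (+-comm 10 i) (+-suc i 9) ⟩
  suc i + 9   ≤⟨ +-monoˡ-≤ 9 i< ⟩
  m ∸ 9 + 9   ≡⟨ m∸n+n≡m 9≤m ⟩
  m           ∎
  where
  open ≤-Reasoning
  9≤m : 9 ≤ m
  9≤m = <⇒≤ (m∸n≢0⇒n<m (λ m∸9≡0 → n≮0 (subst (i <_) m∸9≡0 i<)))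

varGadget-size : ∀ m {i} → i < m ∸ 9 → size (varGadget m i) ≡ suc m
varGadget-size m {i} i< = begin
  size (app Ω (lamN i (var (m ∸ 10 ∸ i))))   ≡⟨ cong (10 +_) (size-lamN i (var (m ∸ 10 ∸ i))) ⟩
  10 + (i + suc (m ∸ 10 ∸ i))                ≡⟨ cong (10 +_) (+-suc i (m ∸ 10 ∸ i)) ⟩
  11 + (i + (m ∸ 10 ∸ i))                    ≡⟨ cong (11 +_) (m+[n∸m]≡n i≤) ⟩
  suc (10 + (m ∸ 10))                        ≡⟨ cong suc (m+[n∸m]≡n 10≤) ⟩
  suc m                                      ∎
  where
  open ≡-Reasoning
  10+i≤m : 10 + i ≤ m
  10+i≤m = varGadget-room m i<
  10≤ : 10 ≤ m
  10≤ = m+n≤o⇒m≤o 10 10+i≤m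
  i≤ : i ≤ m ∸ 10
  i≤ = subst (_≤ m ∸ 10) (m+n∸m≡n 10 i) (∸-monoˡ-≤ 10 10+i≤m)

lamN-var-injective : ∀ i i' {j j'} → lamN i (var j) ≡ lamN i' (var j') → i ≡ i'
lamN-var-injective zero     zero     e = refl
lamN-var-injective (suc i)  (suc i') e = cong suc (lamN-var-injective i i' (lam-injective e))

varGadgets-unique : ∀ m → Unique (varGadgets m)
varGadgets-unique m =
  Unique.map⁺ (λ e → lamN-var-injective _ _ (app-injectiveʳ e)) (Unique.upTo⁺ (m ∸ 9))

length-varGadgets : ∀ m → length (varGadgets m) ≡ m ∸ 9
length-varGadgets m = trans (length-map (varGadget m) (upTo (m ∸ 9))) (length-applyUpTo (λ i → i) (m ∸ 9))

lamN-Ω-free : ∀ k {t} → Ω-free t → Ω-free (lamN k t)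
lamN-Ω-free zero    a o        = a o
lamN-Ω-free (suc k) a (oLam o) = lamN-Ω-free k a o

occ-varGadget : ∀ m i {d} → Occ (varGadget m i) d → d ≡ 1
occ-varGadget m i (here ())
occ-varGadget m i (oL o) = cong suc (occ-Ω o)
occ-varGadget m i (oR o) = ⊥-elim (lamN-Ω-free i var-Ω-free o)

subterms : Term → List Term
subterms (var m)   = [ var m ]
subterms (lam s)   = lam s ∷ subterms s
subterms (app u v) = app u v ∷ (subterms u ++ subterms v)

Σpos : (Term → ℕ) → Term → ℕ
Σpos f t = sumOf f (subterms t)

Σpos-app : ∀ f u v → Σpos f (app u v) ≡ f (app u v) + (Σpos f u + Σpos f v)
Σpos-app f u v = cong (f (app u v) +_) (sumOf-++ f (subterms u) (subterms v))

-- §6. Local rewrites, applied at every position of a term.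

record Rewrite : Set where
  field
    local        : Term → List Term
    depth        : ℕ
    local-size   : ∀ {t e} → e ∈ local t → size e ≡ size t
    local-occ    : ∀ {t e} → e ∈ local t → Occ e depth
    local-exact  : ∀ {t e d} → Ω-free t → e ∈ local t → Occ e d → d ≡ depth
    local-inj    : ∀ {t₁ t₂ e} → e ∈ local t₁ → e ∈ local t₂ → t₁ ≡ t₂
    local-unique : ∀ t → Unique (local t)

module _ (ρ : Rewrite) where
  open Rewrite ρ

  everywhere : Term → List Term
  everywhere (var m)   = local (var m)
  everywhere (lam s)   = local (lam s) ++ map lam (everywhere s)
  everywhere (app u v) = local (app u v) ++ (map (λ u' → app u' v) (everywhere u) ++ map (app u) (everywhere v))

  length-everywhere : ∀ t → length (everywhere t) ≡ Σpos (λ x → length (local x)) t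
  length-everywhere (var m)   = sym (+-identityʳ _)
  length-everywhere (lam s)   =
    trans (length-++ (local (lam s))) (cong (length (local (lam s)) +_)
      (trans (length-map lam (everywhere s)) (length-everywhere s)))
  length-everywhere (app u v) = begin
    length (everywhere (app u v))
      ≡⟨ length-++ (local (app u v)) ⟩
    length (local (app u v)) + length (map (λ u' → app u' v) (everywhere u) ++ map (app u) (everywhere v))
      ≡⟨ cong (length (local (app u v)) +_) (trans (length-++ (map (λ u' → app u' v) (everywhere u)))
           (cong₂ _+_ (length-map _ (everywhere u)) (length-map _ (everywhere v)))) ⟩
    length (local (app u v)) + (length (everywhere u) + length (everywhere v))
      ≡⟨ cong (λ n → length (local (app u v)) + n) (cong₂ _+_ (length-everywhere u) (length-everywhere v)) ⟩
    length (local (app u v)) + (Σpos (λ x → length (local x)) u + Σpos (λ x → length (local x)) v)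
      ≡⟨ sym (Σpos-app (λ x → length (local x)) u v) ⟩
    Σpos (λ x → length (local x)) (app u v) ∎
    where open ≡-Reasoning

  data Origin : Term → Term → Set where
    atRoot : ∀ {t e} → e ∈ local t → Origin t e
    inBody : ∀ {s s'} → s' ∈ everywhere s → Origin (lam s) (lam s')
    inFun  : ∀ {u u' v} → u' ∈ everywhere u → Origin (app u v) (app u' v)
    inArg  : ∀ {u v v'} → v' ∈ everywhere v → Origin (app u v) (app u v')

  origin : ∀ t {e} → e ∈ everywhere t → Origin t e
  origin (var m)   e∈ = atRoot e∈
  origin (lam s)   e∈ with ∈-++⁻ (local (lam s)) e∈
  ... | inj₁ l = atRoot l
  ... | inj₂ m with ∈-map⁻ lam m
  ... | s' , s'∈ , refl = inBody s'∈
  origin (app u v) e∈ with ∈-++⁻ (local (app u v)) e∈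
  ... | inj₁ l = atRoot l
  ... | inj₂ m with ∈-++⁻ (map (λ u' → app u' v) (everywhere u)) m
  ... | inj₁ mu with ∈-map⁻ (λ u' → app u' v) mu
  ... | u' , u'∈ , refl = inFun u'∈
  origin (app u v) e∈ | inj₂ m | inj₂ mv with ∈-map⁻ (app u) mv
  ... | v' , v'∈ , refl = inArg v'∈

  everywhere-size : ∀ t {e} → e ∈ everywhere t → size e ≡ size t
  everywhere-size t e∈ with origin t e∈
  ... | atRoot l              = local-size l
  ... | inBody {s} s'∈        = cong suc (everywhere-size s s'∈)
  ... | inFun {u} {v = v} u'∈ = cong (λ n → suc (n + size v)) (everywhere-size u u'∈)
  ... | inArg {u} {v} v'∈     = cong (λ n → suc (size u + n)) (everywhere-size v v'∈)

  Planted : Term → Set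
  Planted e = ∃[ d ] depth ≤ d × Occ e d

  Deep : Term → Set
  Deep e = ∃[ d ] depth ≤ d × Occ e (suc d)

  deep⇒planted : ∀ {e} → Deep e → Planted e
  deep⇒planted (d , le , o) = suc d , m≤n⇒m≤1+n le , o

  everywhere-planted : ∀ t {e} → e ∈ everywhere t → Planted e
  deepen : ∀ {f : Term → Term} → (∀ {x d} → Occ x d → Occ (f x) (suc d)) →
           ∀ t {x} → x ∈ everywhere t → Deep (f x)

  everywhere-planted t e∈ with origin t e∈
  ... | atRoot l          = depth , ≤-refl , local-occ l
  ... | inBody {s} s'∈    = deep⇒planted (deepen oLam s s'∈)
  ... | inFun {u} u'∈     = deep⇒planted (deepen oL u u'∈)
  ... | inArg {v = v} v'∈ = deep⇒planted (deepen oR v v'∈)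

  deepen wrap t x∈ with everywhere-planted t x∈
  ... | d , le , o = d , le , wrap o

  everywhere-¬Ω-free : ∀ t {e} → e ∈ everywhere t → ¬ Ω-free e
  everywhere-¬Ω-free t e∈ a with everywhere-planted t e∈
  ... | _ , _ , o = a o

  root-shallow : ∀ {t e} → Ω-free t → e ∈ local t → ¬ Deep e
  root-shallow a l (d , le , o) = n≮n d (subst (_≤ d) (sym (local-exact a l o)) le)

  root-origin : ∀ {t t' e} → Ω-free t → e ∈ local t → Origin t' e → t ≡ t'
  root-origin a l (atRoot l')           = local-inj l l'
  root-origin a l (inBody {s} s'∈)      = ⊥-elim (root-shallow a l (deepen oLam s s'∈))
  root-origin a l (inFun {u} u'∈)       = ⊥-elim (root-shallow a l (deepen oL u u'∈))
  root-origin a l (inArg {v = v} v'∈)   = ⊥-elim (root-shallow a l (deepen oR v v'∈))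

  -- Different Ω-free terms have disjoint sets of replacements: the position of
  -- the planted Ω, and the term around it, determine the original.
  everywhere-disjoint : ∀ {t₁ t₂ e} → Ω-free t₁ → Ω-free t₂ →
                        e ∈ everywhere t₁ → e ∈ everywhere t₂ → t₁ ≡ t₂
  everywhere-disjoint {t₁} {t₂} a₁ a₂ e∈₁ e∈₂ = same a₁ a₂ (origin t₁ e∈₁) (origin t₂ e∈₂)
    where
    same : ∀ {t₁ t₂ e} → Ω-free t₁ → Ω-free t₂ → Origin t₁ e → Origin t₂ e → t₁ ≡ t₂
    same a₁ a₂ (atRoot l₁)    o₂             = root-origin a₁ l₁ o₂
    same a₁ a₂ o₁             (atRoot l₂)    = sym (root-origin a₂ l₂ o₁)
    same a₁ a₂ (inBody m₁)    (inBody m₂)    =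
      cong lam (everywhere-disjoint (λ o → a₁ (oLam o)) (λ o → a₂ (oLam o)) m₁ m₂)
    same a₁ a₂ (inFun m₁)     (inFun m₂)     =
      cong (λ u → app u _) (everywhere-disjoint (λ o → a₁ (oL o)) (λ o → a₂ (oL o)) m₁ m₂)
    same a₁ a₂ (inArg m₁)     (inArg m₂)     =
      cong (app _) (everywhere-disjoint (λ o → a₁ (oR o)) (λ o → a₂ (oR o)) m₁ m₂)
    same a₁ a₂ (inFun {u} m₁) (inArg _)      = ⊥-elim (everywhere-¬Ω-free u m₁ (λ o → a₂ (oL o)))
    same a₁ a₂ (inArg _)      (inFun {u} m₂) = ⊥-elim (everywhere-¬Ω-free u m₂ (λ o → a₁ (oL o)))

  everywhere-unique : ∀ t → Ω-free t → Unique (everywhere t)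
  everywhere-unique (var m)   a = local-unique (var m)
  everywhere-unique (lam s)   a =
    Unique.++⁺ (local-unique (lam s)) (Unique.map⁺ lam-injective (everywhere-unique s (λ o → a (oLam o))))
      root-vs-body
    where
    root-vs-body : ∀ {x} → ¬ (x ∈ local (lam s) × x ∈ map lam (everywhere s))
    root-vs-body (l , x∈) with ∈-map⁻ lam x∈
    ... | s' , s'∈ , refl = root-shallow a l (deepen oLam s s'∈)
  everywhere-unique (app u v) a =
    Unique.++⁺ (local-unique (app u v))
      (Unique.++⁺ (Unique.map⁺ app-injectiveˡ (everywhere-unique u (λ o → a (oL o))))
                  (Unique.map⁺ app-injectiveʳ (everywhere-unique v (λ o → a (oR o))))
                  fun-vs-arg)
      root-vs-below
    where
    fun-vs-arg : ∀ {x} → ¬ (x ∈ map (λ u' → app u' v) (everywhere u) × x ∈ map (app u) (everywhere v))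
    fun-vs-arg (x∈₁ , x∈₂) with ∈-map⁻ (λ u' → app u' v) x∈₁ | ∈-map⁻ (app u) x∈₂
    ... | u' , u'∈ , refl | _ , _ , eq =
      everywhere-¬Ω-free u u'∈ (subst Ω-free (sym (app-injectiveˡ eq)) (λ o → a (oL o)))
    root-vs-below : ∀ {x} → ¬ (x ∈ local (app u v) ×
                                x ∈ (map (λ u' → app u' v) (everywhere u) ++ map (app u) (everywhere v)))
    root-vs-below (l , x∈) with ∈-++⁻ (map (λ u' → app u' v) (everywhere u)) x∈
    ... | inj₁ x∈₁ with ∈-map⁻ (λ u' → app u' v) x∈₁
    ... | u' , u'∈ , refl = root-shallow a l (deepen oL u u'∈)
    root-vs-below (l , x∈) | inj₂ x∈₂ with ∈-map⁻ (app u) x∈₂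
    ... | v' , v'∈ , refl = root-shallow a l (deepen oR v v'∈)

  replaceAll : List Term → List Term
  replaceAll []       = []
  replaceAll (t ∷ ts) = everywhere t ++ replaceAll ts

  length-replaceAll : ∀ ts → length (replaceAll ts) ≡ sumOf (λ t → length (everywhere t)) ts
  length-replaceAll []       = refl
  length-replaceAll (t ∷ ts) = trans (length-++ (everywhere t)) (cong (length (everywhere t) +_) (length-replaceAll ts))

  replaceAll-size : ∀ {n} ts → All (λ t → size t ≡ n) ts → All (λ e → size e ≡ n) (replaceAll ts)
  replaceAll-size []       []            = []
  replaceAll-size (t ∷ ts) (size≡ ∷ all) =
    AllP.++⁺ (All.tabulate (λ e∈ → trans (everywhere-size t e∈) size≡)) (replaceAll-size ts all)

  replaceAll-∈ : ∀ ts {e} → e ∈ replaceAll ts → ∃[ t ] t ∈ ts × e ∈ everywhere t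
  replaceAll-∈ (t ∷ ts) e∈ with ∈-++⁻ (everywhere t) e∈
  ... | inj₁ e∈t  = t , here refl , e∈t
  ... | inj₂ e∈ts with replaceAll-∈ ts e∈ts
  ... | t' , t'∈ , e∈t' = t' , there t'∈ , e∈t'

  replaceAll-unique : ∀ ts → Unique ts → All Ω-free ts → Unique (replaceAll ts)
  replaceAll-unique []       []            []       = []
  replaceAll-unique (t ∷ ts) (t∉ ∷ uniq) (a ∷ as) =
    Unique.++⁺ (everywhere-unique t a) (replaceAll-unique ts uniq as) disjoint
    where
    disjoint : ∀ {e} → ¬ (e ∈ everywhere t × e ∈ replaceAll ts)
    disjoint (e∈t , e∈ts) with replaceAll-∈ ts e∈ts
    ... | t' , t'∈ , e∈t' = All.lookup t∉ t'∈ (everywhere-disjoint a (All.lookup as t'∈) e∈t e∈t')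

-- §7. The two kinds of local rewrites: variable gadgets and pattern gadgets.

varLocal : Term → List Term
varLocal (var m)   = varGadgets m
varLocal (lam _)   = []
varLocal (app _ _) = []

varGadgets-∈ : ∀ {m e} → e ∈ varGadgets m → ∃[ i ] i < m ∸ 9 × e ≡ varGadget m i
varGadgets-∈ {m} e∈ with ∈-map⁻ (varGadget m) e∈
... | i , i∈ , refl = i , ∈-upTo⁻ i∈ , refl

varRewrite : Rewrite
varRewrite = record
  { local        = varLocal
  ; depth        = 1
  ; local-size   = λ {t} → size-ok t
  ; local-occ    = λ {t} → occ-ok t
  ; local-exact  = λ {t} _ → exact-ok t
  ; local-inj    = λ {t₁} {t₂} → inj-ok t₁ t₂
  ; local-unique = unique-ok
  }
  where
  size-ok : ∀ t {e} → e ∈ varLocal t → size e ≡ size t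
  size-ok (var m) e∈ with varGadgets-∈ {m} e∈
  ... | i , i< , refl = varGadget-size m i<

  occ-ok : ∀ t {e} → e ∈ varLocal t → Occ e 1
  occ-ok (var m) e∈ with varGadgets-∈ {m} e∈
  ... | i , _ , refl = oL (here refl)

  exact-ok : ∀ t {e d} → e ∈ varLocal t → Occ e d → d ≡ 1
  exact-ok (var m) e∈ o with varGadgets-∈ {m} e∈
  ... | i , _ , refl = occ-varGadget m i o

  -- Equal gadgets have equal sizes, and the size of a gadget of m is m + 1.
  inj-ok : ∀ t₁ t₂ {e} → e ∈ varLocal t₁ → e ∈ varLocal t₂ → t₁ ≡ t₂
  inj-ok (var m₁) (var m₂) e∈₁ e∈₂ =
    cong var (suc-injective (trans (sym (size-ok (var m₁) e∈₁)) (size-ok (var m₂) e∈₂)))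

  unique-ok : ∀ t → Unique (varLocal t)
  unique-ok (var m)   = varGadgets-unique m
  unique-ok (lam _)   = []
  unique-ok (app _ _) = []

patLocal : Pat → Term → List Term
patLocal π t with frag 10 t ≟ₚ π | 10 ≤? patWeight π
... | yes _ | yes _ = [ gadget π (holes 10 t) ]
... | _     | _     = []

patLocal-∈ : ∀ {π t e} → e ∈ patLocal π t →
             frag 10 t ≡ π × 10 ≤ patWeight π × e ≡ gadget π (holes 10 t)
patLocal-∈ {π} {t} e∈ with frag 10 t ≟ₚ π | 10 ≤? patWeight π
patLocal-∈ (here refl) | yes f≡ | yes heavy = f≡ , heavy , refl

patLocal-unique : ∀ π t → Unique (patLocal π t)
patLocal-unique π t with frag 10 t ≟ₚ π | 10 ≤? patWeight π
... | yes _ | yes _ = [] ∷ []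
... | yes _ | no _  = []
... | no _  | _     = []

patLocal-heavy : ∀ t → 10 ≤ patWeight (frag 10 t) → length (patLocal (frag 10 t) t) ≡ 1
patLocal-heavy t heavy with frag 10 t ≟ₚ frag 10 t | 10 ≤? patWeight (frag 10 t)
... | yes _ | yes _     = refl
... | yes _ | no light  = ⊥-elim (light heavy)
... | no f≢ | _         = ⊥-elim (f≢ refl)

patRewrite : Pat → Rewrite
patRewrite π = record
  { local        = patLocal π
  ; depth        = pad π + holeCount π
  ; local-size   = size-ok
  ; local-occ    = occ-ok
  ; local-exact  = exact-ok
  ; local-inj    = inj-ok
  ; local-unique = patLocal-unique π
  }
  where
  size-ok : ∀ {t e} → e ∈ patLocal π t → size e ≡ size t
  size-ok {t} e∈ with patLocal-∈ {π} {t} e∈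
  ... | refl , heavy , refl =
    trans (gadget-size (frag 10 t) (holes 10 t) heavy (length-holes 10 t)) (sym (size-frag 10 t))

  occ-ok : ∀ {t e} → e ∈ patLocal π t → Occ e (pad π + holeCount π)
  occ-ok {t} e∈ with patLocal-∈ {π} {t} e∈
  ... | refl , _ , refl =
    subst (Occ _) (cong (pad (frag 10 t) +_) (length-holes 10 t)) (gadget-occ (frag 10 t) (holes 10 t))

  exact-ok : ∀ {t e d} → Ω-free t → e ∈ patLocal π t → Occ e d → d ≡ pad π + holeCount π
  exact-ok {t} a e∈ o with patLocal-∈ {π} {t} e∈
  ... | refl , _ , refl =
    trans (occ-gadget (frag 10 t) (holes 10 t) (holes-Ω-free 10 t a) o) (cong (pad (frag 10 t) +_) (length-holes 10 t))

  -- The gadget returns the holes, and together with the fragment they determine the term.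
  inj-ok : ∀ {t₁ t₂ e} → e ∈ patLocal π t₁ → e ∈ patLocal π t₂ → t₁ ≡ t₂
  inj-ok {t₁} {t₂} e∈₁ e∈₂ with patLocal-∈ {π} {t₁} e∈₁ | patLocal-∈ {π} {t₂} e∈₂
  ... | f₁ , _ , refl | f₂ , _ , same =
    frag-holes-injective 10 (trans f₁ (sym f₂)) (spine-injective (lamN-injective (pad π) same))

-- §8. Weight counting: a large term has many heavy positions or a large
-- total variable excess.

nodeWeight : Term → ℕ
nodeWeight (var m)   = if m <ᵇ 10 then 2 else 0
nodeWeight (lam _)   = 1
nodeWeight (app _ _) = 0

weight : Term → ℕ
weight = Σpos nodeWeight

fragWeight : ℕ → Term → ℕ
fragWeight d t = patWeight (frag d t)

fragWeight-var : ∀ d m → fragWeight (suc d) (var m) ≡ nodeWeight (var m)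
fragWeight-var d m with m <ᵇ 10
... | true  = refl
... | false = refl

shallowWeight : ℕ → Term → ℕ
shallowWeight zero    t = 0
shallowWeight (suc d) t = shallowWeight d t + fragWeight d t

shallow-var : ∀ d m → shallowWeight (suc d) (var m) ≡ d * nodeWeight (var m)
shallow-var zero    m = refl
shallow-var (suc d) m = trans (cong₂ _+_ (shallow-var d m) (fragWeight-var d m)) (+-comm (d * nodeWeight (var m)) _)

shallow-lam : ∀ d s → shallowWeight (suc d) (lam s) ≡ d + shallowWeight d s
shallow-lam zero    s = refl
shallow-lam (suc d) s = trans (cong (_+ suc (fragWeight d s)) (shallow-lam d s)) (rearrange d _ _)
  where
  rearrange : ∀ d b f → d + b + suc f ≡ suc d + (b + f)
  rearrange = solve-∀

shallow-app : ∀ d u v → shallowWeight (suc d) (app u v) ≡ shallowWeight d u + shallowWeight d v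
shallow-app zero    u v = refl
shallow-app (suc d) u v =
  trans (cong (_+ (fragWeight d u + fragWeight d v)) (shallow-app d u v))
        (interchange (shallowWeight d u) (shallowWeight d v) (fragWeight d u) (fragWeight d v))

-- Double counting: a node at distance j below a position contributes its weight
-- to the depth-d fragment there iff j < d.  Summing the fragment weights over all
-- positions counts every node d times, except for the missing ancestors of the
-- nodes near the root, which shallowWeight supplies.
weight-count : ∀ d t → Σpos (fragWeight d) t + shallowWeight d t ≡ d * weight t
weight-count d (var m) = begin
  fragWeight d (var m) + 0 + shallowWeight d (var m)   ≡⟨ cong (_+ shallowWeight d (var m)) (+-identityʳ _) ⟩
  fragWeight d (var m) + shallowWeight d (var m)       ≡⟨ +-comm (fragWeight d (var m)) _ ⟩
  shallowWeight (suc d) (var m)                        ≡⟨ shallow-var d m ⟩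
  d * nodeWeight (var m)                               ≡⟨ cong (d *_) (sym (+-identityʳ _)) ⟩
  d * (nodeWeight (var m) + 0)                         ∎
  where open ≡-Reasoning
weight-count d (lam s) = begin
  fragWeight d (lam s) + Σpos (fragWeight d) s + shallowWeight d (lam s)
    ≡⟨ rearrange (fragWeight d (lam s)) (Σpos (fragWeight d) s) (shallowWeight d (lam s)) ⟩
  shallowWeight (suc d) (lam s) + Σpos (fragWeight d) s
    ≡⟨ cong (_+ Σpos (fragWeight d) s) (shallow-lam d s) ⟩
  d + shallowWeight d s + Σpos (fragWeight d) s
    ≡⟨ trans (+-assoc d _ _) (cong (d +_) (+-comm (shallowWeight d s) _)) ⟩
  d + (Σpos (fragWeight d) s + shallowWeight d s)
    ≡⟨ cong (d +_) (weight-count d s) ⟩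
  d + d * weight s
    ≡⟨ sym (*-suc d (weight s)) ⟩
  d * suc (weight s) ∎
  where
  open ≡-Reasoning
  rearrange : ∀ f p b → f + p + b ≡ b + f + p
  rearrange = solve-∀
weight-count d (app u v) = begin
  Σpos (fragWeight d) (app u v) + shallowWeight d (app u v)
    ≡⟨ cong (_+ shallowWeight d (app u v)) (Σpos-app (fragWeight d) u v) ⟩
  fragWeight d (app u v) + (Σpos (fragWeight d) u + Σpos (fragWeight d) v) + shallowWeight d (app u v)
    ≡⟨ rearrange (fragWeight d (app u v)) (Σpos (fragWeight d) u) (Σpos (fragWeight d) v)
                 (shallowWeight d (app u v)) ⟩
  shallowWeight (suc d) (app u v) + (Σpos (fragWeight d) u + Σpos (fragWeight d) v)
    ≡⟨ cong (_+ (Σpos (fragWeight d) u + Σpos (fragWeight d) v)) (shallow-app d u v) ⟩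
  shallowWeight d u + shallowWeight d v + (Σpos (fragWeight d) u + Σpos (fragWeight d) v)
    ≡⟨ interchange (shallowWeight d u) (shallowWeight d v) (Σpos (fragWeight d) u) (Σpos (fragWeight d) v) ⟩
  (shallowWeight d u + Σpos (fragWeight d) u) + (shallowWeight d v + Σpos (fragWeight d) v)
    ≡⟨ cong₂ _+_ (trans (+-comm (shallowWeight d u) _) (weight-count d u))
                 (trans (+-comm (shallowWeight d v) _) (weight-count d v)) ⟩
  d * weight u + d * weight v
    ≡⟨ sym (*-distribˡ-+ d (weight u) (weight v)) ⟩
  d * (weight u + weight v)
    ≡⟨ cong (d *_) (sym (Σpos-app nodeWeight u v)) ⟩
  d * weight (app u v) ∎
  where
  open ≡-Reasoning
  rearrange : ∀ f p q b → f + (p + q) + b ≡ b + f + (p + q)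
  rearrange = solve-∀

double-2^ : ∀ d → 2 * 2 ^ d + 2 * 2 ^ d ≡ 2 * 2 ^ suc d
double-2^ d = double (2 ^ d)
  where
  double : ∀ x → 2 * x + 2 * x ≡ 2 * (2 * x)
  double = solve-∀

fragWeight-mono : ∀ d t → fragWeight d t ≤ fragWeight (suc d) t
fragWeight-mono zero    t         = z≤n
fragWeight-mono (suc d) (var m)   = ≤-refl
fragWeight-mono (suc d) (lam s)   = s≤s (fragWeight-mono d s)
fragWeight-mono (suc d) (app u v) = +-mono-≤ (fragWeight-mono d u) (fragWeight-mono d v)

fragWeight-bound : ∀ d t → fragWeight d t ≤ 2 * 2 ^ d
fragWeight-bound zero    t         = z≤n
fragWeight-bound (suc d) (var m)   = begin
  fragWeight (suc d) (var m) ≡⟨ fragWeight-var d m ⟩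
  nodeWeight (var m)         ≤⟨ var≤2 ⟩
  2 * 1                      ≤⟨ *-monoʳ-≤ 2 (m^n>0 2 (suc d)) ⟩
  2 * 2 ^ suc d              ∎
  where
  open ≤-Reasoning
  var≤2 : nodeWeight (var m) ≤ 2
  var≤2 with m <ᵇ 10
  ... | true  = ≤-refl
  ... | false = z≤n
fragWeight-bound (suc d) (lam s)   = begin
  suc (fragWeight d s)          ≤⟨ s≤s (fragWeight-bound d s) ⟩
  suc (2 * 2 ^ d)               ≤⟨ +-monoˡ-≤ (2 * 2 ^ d) (≤-trans (m^n>0 2 d) (m≤m+n (2 ^ d) _)) ⟩
  2 * 2 ^ d + 2 * 2 ^ d         ≡⟨ double-2^ d ⟩
  2 * 2 ^ suc d                 ∎
  where open ≤-Reasoning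
fragWeight-bound (suc d) (app u v) = begin
  fragWeight d u + fragWeight d v   ≤⟨ +-mono-≤ (fragWeight-bound d u) (fragWeight-bound d v) ⟩
  2 * 2 ^ d + 2 * 2 ^ d             ≡⟨ double-2^ d ⟩
  2 * 2 ^ suc d                     ∎
  where open ≤-Reasoning

shallow-bound : ∀ d t → shallowWeight d t ≤ d * fragWeight d t
shallow-bound zero    t = z≤n
shallow-bound (suc d) t = begin
  shallowWeight d t + fragWeight d t            ≤⟨ +-mono-≤ (shallow-bound d t) (fragWeight-mono d t) ⟩
  d * fragWeight d t + fragWeight (suc d) t     ≤⟨ +-monoˡ-≤ _ (*-monoʳ-≤ d (fragWeight-mono d t)) ⟩
  d * fragWeight (suc d) t + fragWeight (suc d) t ≡⟨ +-comm (d * fragWeight (suc d) t) _ ⟩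
  suc d * fragWeight (suc d) t                  ∎
  where open ≤-Reasoning

-- A position is heavy when its depth-10 fragment has weight at least 10; this is
-- exactly when the pattern gadget fits.
heavy : Term → ℕ
heavy t with 10 ≤? fragWeight 10 t
... | yes _ = 1
... | no  _ = 0

fragWeight-heavy : ∀ t → fragWeight 10 t ≤ 9 * 1 + 2048 * heavy t
fragWeight-heavy t with 10 ≤? fragWeight 10 t
... | yes _     = ≤-trans (fragWeight-bound 10 t) (m≤n+m 2048 9)
... | no  light = ≤-trans (≤-pred (≰⇒> light)) (m≤m+n 9 0)

-- The excess of a variable of index m is m ∸ 9 (its size beyond 10); bigVar
-- marks the variables of index ≥ 10, which count as holes in fragments.
excess : Term → ℕ
excess (var m)   = m ∸ 9
excess (lam _)   = 0
excess (app _ _) = 0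

bigVar : Term → ℕ
bigVar (var m)   = if m <ᵇ 10 then 0 else 1
bigVar (lam _)   = 0
bigVar (app _ _) = 0

bigVar≤excess : ∀ t → bigVar t ≤ excess t
bigVar≤excess (var m) with m <ᵇ 10 in small
... | true  = z≤n
... | false = ∸-monoˡ-≤ {10} {m} 9 (≮⇒≥ (λ m<10 → subst T small (<⇒<ᵇ m<10)))
bigVar≤excess (lam _)   = z≤n
bigVar≤excess (app _ _) = z≤n

nodes : Term → ℕ
nodes = Σpos (λ _ → 1)

-- Every node has weight 2 (variables), 1 (λ) or 0 (application), and a
-- binary tree has one more leaf than application nodes.
nodes-weight : ∀ t → nodes t + 1 ≡ weight t + 2 * Σpos bigVar t
nodes-weight (var m) with m <ᵇ 10
... | true  = refl
... | false = refl
nodes-weight (lam s) = cong suc (nodes-weight s)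
nodes-weight (app u v) = begin
  Σpos (λ _ → 1) (app u v) + 1
    ≡⟨ cong (_+ 1) (Σpos-app (λ _ → 1) u v) ⟩
  1 + (nodes u + nodes v) + 1
    ≡⟨ rearrange (nodes u) (nodes v) ⟩
  (nodes u + 1) + (nodes v + 1)
    ≡⟨ cong₂ _+_ (nodes-weight u) (nodes-weight v) ⟩
  (weight u + 2 * Σpos bigVar u) + (weight v + 2 * Σpos bigVar v)
    ≡⟨ rearrange′ (weight u) (weight v) (Σpos bigVar u) (Σpos bigVar v) ⟩
  0 + (weight u + weight v) + 2 * (0 + (Σpos bigVar u + Σpos bigVar v))
    ≡⟨ sym (cong₂ (λ w b → w + 2 * b) (Σpos-app nodeWeight u v) (Σpos-app bigVar u v)) ⟩
  weight (app u v) + 2 * Σpos bigVar (app u v) ∎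
  where
  open ≡-Reasoning
  rearrange : ∀ a b → 1 + (a + b) + 1 ≡ (a + 1) + (b + 1)
  rearrange = solve-∀
  rearrange′ : ∀ a b c e → (a + 2 * c) + (b + 2 * e) ≡ 0 + (a + b) + 2 * (0 + (c + e))
  rearrange′ = solve-∀

ownSize : Term → ℕ
ownSize (var m)   = suc m
ownSize (lam _)   = 1
ownSize (app _ _) = 1

size-Σpos : ∀ t → size t ≡ Σpos ownSize t
size-Σpos (var m)   = sym (+-identityʳ (suc m))
size-Σpos (lam s)   = cong suc (size-Σpos s)
size-Σpos (app u v) = trans (cong suc (cong₂ _+_ (size-Σpos u) (size-Σpos v))) (sym (Σpos-app ownSize u v))

Σpos-linear : ∀ a b f g t → Σpos (λ x → a * f x + b * g x) t ≡ a * Σpos f t + b * Σpos g t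
Σpos-linear a b f g t = trans (sumOf-+ (λ x → a * f x) (λ x → b * g x) (subterms t))
                              (cong₂ _+_ (sumOf-* a f (subterms t)) (sumOf-* b g (subterms t)))

Σpos-mono : ∀ {f g} → (∀ x → f x ≤ g x) → ∀ t → Σpos f t ≤ Σpos g t
Σpos-mono f≤g t = sumOf-mono f≤g (subterms t)

size-nodes : ∀ t → size t ≤ 10 * nodes t + 1 * Σpos excess t
size-nodes t = begin
  size t                                    ≡⟨ size-Σpos t ⟩
  Σpos ownSize t                            ≤⟨ Σpos-mono own≤ t ⟩
  Σpos (λ x → 10 * 1 + 1 * excess x) t      ≡⟨ Σpos-linear 10 1 (λ _ → 1) excess t ⟩
  10 * nodes t + 1 * Σpos excess t          ∎
  where
  open ≤-Reasoning
  own≤ : ∀ x → ownSize x ≤ 10 * 1 + 1 * excess x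
  own≤ (var m)   = s≤s (subst (m ≤_) (cong (9 +_) (sym (+-identityʳ (m ∸ 9)))) (m≤n+m∸n m 9))
  own≤ (lam _)   = s≤s z≤n
  own≤ (app _ _) = s≤s z≤n

-- Counting weights: a term with few heavy positions and small variables has
-- few nodes, since nodes are paid for by weight, weight by fragment weight, and
-- light fragments are light.
nodes-bound : ∀ t → nodes t ≤ 2048 * Σpos heavy t + 20 * Σpos excess t + 20480
nodes-bound t = ≤-trans (m≤m+n (nodes t) 10) (+-cancelˡ-≤ (9 * nodes t) _ _ (begin
  9 * nodes t + (nodes t + 10)
    ≡⟨ rearrange (nodes t) ⟩
  10 * (nodes t + 1)
    ≡⟨ cong (10 *_) (nodes-weight t) ⟩
  10 * (weight t + 2 * Σpos bigVar t)
    ≡⟨ trans (*-distribˡ-+ 10 (weight t) _) (cong (10 * weight t +_) (sym (*-assoc 10 2 (Σpos bigVar t)))) ⟩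
  10 * weight t + 20 * Σpos bigVar t
    ≡⟨ cong (_+ 20 * Σpos bigVar t) (sym (weight-count 10 t)) ⟩
  Σpos (fragWeight 10) t + shallowWeight 10 t + 20 * Σpos bigVar t
    ≤⟨ +-mono-≤ (+-mono-≤ fragments-light shallow-light) (*-monoʳ-≤ 20 (Σpos-mono bigVar≤excess t)) ⟩
  9 * nodes t + 2048 * Σpos heavy t + 10 * (2 * 2 ^ 10) + 20 * Σpos excess t
    ≡⟨ rearrange′ (nodes t) (Σpos heavy t) (Σpos excess t) ⟩
  9 * nodes t + (2048 * Σpos heavy t + 20 * Σpos excess t + 20480) ∎))
  where
  open ≤-Reasoning
  fragments-light : Σpos (fragWeight 10) t ≤ 9 * nodes t + 2048 * Σpos heavy t
  fragments-light = ≤-trans (Σpos-mono fragWeight-heavy t) (≤-reflexive (Σpos-linear 9 2048 (λ _ → 1) heavy t))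
  shallow-light : shallowWeight 10 t ≤ 10 * (2 * 2 ^ 10)
  shallow-light = ≤-trans (shallow-bound 10 t) (*-monoʳ-≤ 10 (fragWeight-bound 10 t))
  rearrange : ∀ n → 9 * n + (n + 10) ≡ 10 * (n + 1)
  rearrange = solve-∀
  rearrange′ : ∀ n g x → 9 * n + 2048 * g + 10 * (2 * 2 ^ 10) + 20 * x ≡ 9 * n + (2048 * g + 20 * x + 20480)
  rearrange′ = solve-∀

size-bound : ∀ t → size t ≤ 20681 * (Σpos heavy t + Σpos excess t) + 204800
size-bound t = begin
  size t
    ≤⟨ size-nodes t ⟩
  10 * nodes t + 1 * Σpos excess t
    ≤⟨ +-monoˡ-≤ _ (*-monoʳ-≤ 10 (nodes-bound t)) ⟩
  10 * (2048 * Σpos heavy t + 20 * Σpos excess t + 20480) + 1 * Σpos excess t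
    ≡⟨ rearrange (Σpos heavy t) (Σpos excess t) ⟩
  20480 * Σpos heavy t + 201 * Σpos excess t + 204800
    ≤⟨ +-monoˡ-≤ 204800 (+-mono-≤ (*-monoˡ-≤ (Σpos heavy t) (m≤m+n 20480 201))
                                   (*-monoˡ-≤ (Σpos excess t) (m≤n+m 201 20480))) ⟩
  20681 * Σpos heavy t + 20681 * Σpos excess t + 204800
    ≡⟨ cong (_+ 204800) (sym (*-distribˡ-+ 20681 (Σpos heavy t) _)) ⟩
  20681 * (Σpos heavy t + Σpos excess t) + 204800 ∎
  where
  open ≤-Reasoning
  rearrange : ∀ g x → 10 * (2048 * g + 20 * x + 20480) + 1 * x ≡ 20480 * g + 201 * x + 204800
  rearrange = solve-∀

rewrites : List Pat → List Rewrite
rewrites ps = varRewrite ∷ map patRewrite ps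

replacements : List Rewrite → Term → ℕ
replacements rs t = sumOf (λ ρ → length (everywhere ρ t)) rs

length-varLocal : ∀ t → length (varLocal t) ≡ excess t
length-varLocal (var m)   = length-varGadgets m
length-varLocal (lam _)   = refl
length-varLocal (app _ _) = refl

replacements-bound : ∀ ps → (∀ t → frag 10 t ∈ ps) →
                     ∀ t → Σpos heavy t + Σpos excess t ≤ replacements (rewrites ps) t
replacements-bound ps complete t = begin
  Σpos heavy t + Σpos excess t                         ≡⟨ sym (sumOf-+ heavy excess (subterms t)) ⟩
  Σpos (λ x → heavy x + excess x) t                    ≤⟨ Σpos-mono local-count t ⟩
  Σpos (λ x → sumOf (λ ρ → length (local ρ x)) rs) t
                                                       ≡⟨ sym (sumOf-swap (λ ρ x → length (local ρ x)) rs (subterms t)) ⟩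
  sumOf (λ ρ → Σpos (λ x → length (local ρ x)) t) rs   ≡⟨ sumOf-cong (λ ρ → sym (length-everywhere ρ t)) rs ⟩
  replacements rs t                                    ∎
  where
  open ≤-Reasoning
  open Rewrite using (local)
  rs : List Rewrite
  rs = rewrites ps
  heavy-count : ∀ x → heavy x ≤ sumOf (λ ρ → length (local ρ x)) (map patRewrite ps)
  heavy-count x with 10 ≤? fragWeight 10 x
  ... | yes h = ≤-trans (≤-reflexive (sym (patLocal-heavy x h)))
                        (sumOf-∈ (λ ρ → length (local ρ x)) (∈-map⁺ patRewrite (complete x)))
  ... | no  _ = z≤n
  local-count : ∀ x → heavy x + excess x ≤ sumOf (λ ρ → length (local ρ x)) rs
  local-count x = ≤-trans (≤-reflexive (+-comm (heavy x) (excess x)))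
                          (+-mono-≤ (≤-reflexive (sym (length-varLocal x))) (heavy-count x))

-- The core counting argument, for any finite list ps of patterns containing all
-- depth-10 fragments: a term of size n ≥ 20681·Q + 204800 has at least Q
-- replacements, so by pigeonhole one of the K rewrites alone produces k times as
-- many distinct replacements as there are Ω-free terms, when Q = k·K.
Ω-free-negligible-from : ∀ ps → (∀ t → frag 10 t ∈ ps) → AsymptoticallyNegligible Ω-free
Ω-free-negligible-from ps complete k = 20681 * Q + 204800 , many
  where
  rs : List Rewrite
  rs = rewrites ps
  Q : ℕ
  Q = k * length rs

  enough : ∀ {n} → 20681 * Q + 204800 ≤ n → ∀ {t} → size t ≡ n → Q ≤ replacements rs t
  enough {n} N≤n {t} refl = ≤-trans
    (*-cancelˡ-≤ 20681 (+-cancelʳ-≤ 204800 _ _ (≤-trans N≤n (size-bound t))))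
    (replacements-bound ps complete t)

  many : ∀ n → 20681 * Q + 204800 ≤ n → ∀ xs → Unique xs → All (λ t → size t ≡ n × Ω-free t) xs →
         Σ (List Term) (λ ys → Unique ys × All (λ t → size t ≡ n) ys × (k * length xs ≤ length ys))
  many n N≤n xs uniq all with pigeonhole (k * length xs) (λ ρ → sumOf (λ t → length (everywhere ρ t)) xs)
                                    varRewrite (map patRewrite ps) total
    where
    total : length rs * (k * length xs) ≤ sumOf (λ ρ → sumOf (λ t → length (everywhere ρ t)) xs) rs
    total = begin
      length rs * (k * length xs)  ≡⟨ rearrange (length rs) k (length xs) ⟩
      length xs * Q
        ≤⟨ sumOf-lower Q (replacements rs) (All.map (λ p → enough N≤n (proj₁ p)) all) ⟩
      sumOf (replacements rs) xs   ≡⟨ sumOf-swap (λ t ρ → length (everywhere ρ t)) xs rs ⟩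
      sumOf (λ ρ → sumOf (λ t → length (everywhere ρ t)) xs) rs ∎
      where
      open ≤-Reasoning
      rearrange : ∀ r k l → r * (k * l) ≡ l * (k * r)
      rearrange = solve-∀
  ... | ρ , big = replaceAll ρ xs
                , replaceAll-unique ρ xs uniq (All.map (λ p {d} → proj₂ p {d}) all)
                , replaceAll-size ρ xs (All.map proj₁ all)
                , ≤-trans big (≤-reflexive (sym (length-replaceAll ρ xs)))

-- Ω-free terms are asymptotically negligible.  (The explicit fragment list is
-- huge; keeping it abstract in the counting argument means it is never unfolded.)
Ω-free-negligible : AsymptoticallyNegligible Ω-free
Ω-free-negligible = Ω-free-negligible-from (fragments 10) (frag∈fragments 10)

negligible-⊆ : ∀ {P R : Term → Set} → (∀ {t} → P t → R t) →
               AsymptoticallyNegligible R → AsymptoticallyNegligible P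
negligible-⊆ P⇒R negligible k with negligible k
... | N , many = N , λ n N≤n xs uniq all → many n N≤n xs uniq (All.map (λ p → proj₁ p , P⇒R (proj₂ p)) all)

mainTheorem17 : AsymptoticallyNegligible SN × AsymptoticallyNegligible Typeable × AsymptoticallyNegligible NormalForm
mainTheorem17 =
    negligible-⊆ (λ s {d} → SN⇒Ω-free s {d}) Ω-free-negligible
  , negligible-⊆ (λ ty {d} → Typeable⇒Ω-free ty {d}) Ω-free-negligible
  , negligible-⊆ (λ nf {d} → NF⇒Ω-free nf {d}) Ω-free-negligible
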